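{- There are infinitely many pairs of finite connected graphs $G\subseteq H$ on the same vertex set (i.e. $H$ is obtained from $G$ by adding edges) such that $G$ is stackable but $H$ is not stackable.
   Context: Cup stacking on a finite connected graph: initially one cup on every vertex; a move takes all $r\ge1$ cups from a vertex $x$ onto a vertex $y\neq x$ that already carries at least one cup and satisfies $d(x,y)=r$ (shortest-path distance). A graph is $t$-stackable if some sequence of moves ends with all cups on $t$, and stackable if it is $t$-stackable for every vertex $t$. -}

module Defs where

open import Data.Nat using (ℕ; zero; suc; _<_; _≥_)
open import Data.Fin using (Fin)
open import Data.Bool using (Bool; true; false)
open import Data.Product using (_×_; Σ; ∃)
open import Relation.Binary.PropositionalEquality using (_≡_; _≢_)
open import Relation.Nullary using (¬_)
open import Relation.Binary.Construct.Closure.ReflexiveTransitive using (Star)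

record Graph (n : ℕ) : Set where
  field
    adj   : Fin n → Fin n → Bool
    sym   : ∀ x y → adj x y ≡ adj y x
    irrefl : ∀ x → adj x x ≡ false
open Graph public

data Walk {n : ℕ} (G : Graph n) : Fin n → Fin n → ℕ → Set where
  here : ∀ {x} → Walk G x x zero
  step : ∀ {x z y k} → adj G x z ≡ true → Walk G z y k → Walk G x y (suc k)

Connected : ∀ {n} → Graph n → Set
Connected G = ∀ x y → ∃ λ k → Walk G x y k

Dist : ∀ {n} → Graph n → Fin n → Fin n → ℕ → Set
Dist G x y r = Walk G x y r × (∀ k → k < r → ¬ Walk G x y k)

_⊆G_ : ∀ {n} → Graph n → Graph n → Set
G ⊆G H = ∀ x y → adj G x y ≡ true → adj H x y ≡ true

-- Cup configurations: number of cups on each vertex.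
Config : ℕ → Set
Config n = Fin n → ℕ

record Move {n} (G : Graph n) (c c' : Config n) : Set where
  field
    from to   : Fin n
    distinct  : from ≢ to
    nonempty  : c from ≥ 1
    occupied  : c to ≥ 1
    distance  : Dist G from to (c from)
    emptied   : c' from ≡ 0
    stacked   : c' to ≡ c to Data.Nat.+ c from
    unchanged : ∀ v → v ≢ from → v ≢ to → c' v ≡ c v

initial : ∀ {n} → Config n
initial _ = 1

AllOn : ∀ {n} → Fin n → Config n → Set
AllOn {n} t c = c t ≡ n × (∀ v → v ≢ t → c v ≡ 0)

Stackable-at : ∀ {n} → Graph n → Fin n → Set
Stackable-at G t = ∃ λ c → Star (Move G) initial c × AllOn t c

Stackable : ∀ {n} → Graph n → Set
Stackable {n} G = ∀ (t : Fin n) → Stackable-at G t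

{-# OPTIONS --safe #-}

-- G is a broom: the path a – c – p₁ – … – p_L with a second leaf b at c, and H adds every
-- missing edge at c. In H the centre c has eccentricity 1 and the leaves a, b have
-- eccentricity 2, so a leaf holding one cup can only be emptied into c and a leaf holding
-- three or more cups cannot be emptied at all. Hence along every play on H one of the
-- following persists: c holds at least two cups (and can never move again), c holds one
-- cup and both leaves hold 1 or at least 3 cups, or c is empty and one leaf does; so the
-- cups never all reach p₁.
-- In G every target is reached by composing sweeps. If k cups can be swept onto a vertex x
-- at distance k + 1 from the target, the resulting pile on x can be relayed onto the
-- target; alternating between the two ends, this collects any geodesic segment onto
-- either of its ends, and sweeps of disjoint vertex sets onto the same target compose.
-- A handle of length L ≥ 12 leaves enough room to do this for every target.

module Submission where

open import Defs hiding (sym)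
open import Data.Bool using (Bool; true; not; _∨_; _∧_)
open import Data.Bool.Properties using (∨-comm; ∨-zeroʳ; ∨-identityʳ; ∧-inverseʳ; T-≡)
open import Data.Fin using (Fin; zero; suc; toℕ; inject₁; fromℕ; fromℕ<; punchIn; punchOut)
open import Data.Fin.Patterns using (0F; 1F; 2F; 3F; 4F; 5F; 6F; 7F; 8F)
open import Data.Fin.Properties
  using (_≟_; toℕ-injective; toℕ-inject₁; toℕ-fromℕ; toℕ-fromℕ<; toℕ<n; toℕ≤pred[n];
         fromℕ≢inject₁; punchInᵢ≢i; punchIn-punchOut)
  renaming (suc-injective to Fin-suc-injective)
open import Data.List using (List; []; _∷_; [_]; _++_)
open import Data.List.Membership.Propositional using () renaming (_∈_ to _∈ₗ_)
open import Data.List.Membership.Propositional.Properties using (∈-++⁺ˡ; ∈-++⁺ʳ)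
open import Data.List.Relation.Unary.All using (all?)
import Data.List.Relation.Unary.All as All
open import Data.List.Relation.Unary.Any using (here; there)
import Data.Nat as ℕ
open import Data.Nat
  using (ℕ; _≥_; zero; suc; _+_; _∸_; _≤_; _<_; _≤?_; _<?_; z≤n; s≤s; ∣_-_∣; _≡ᵇ_)
open import Data.Nat.Properties hiding (_≟_)
open import Algebra.Properties.CommutativeMonoid.Sum +-0-commutativeMonoid
  using (sum; sum-remove; ∑-distrib-+; sum-cong-≗; sum-replicate-zero)
open import Data.Product using (Σ; ∃; _×_; _,_)
open import Data.Sum using (_⊎_; inj₁; inj₂)
import Data.Sum as Sum
open import Data.Vec.Functional using (updateAt; removeAt)
open import Data.Vec.Functional.Properties using (updateAt-updates; updateAt-minimal)
open import Function using (_∘_; Equivalence)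
open import Level using (0ℓ)
open import Relation.Binary.Construct.Closure.ReflexiveTransitive using (Star; ε; _◅_; _◅◅_)
open import Relation.Binary.PropositionalEquality hiding ([_])
open import Relation.Nullary using (¬_; yes; no; does; contradiction; ¬?; _×-dec_)
open import Relation.Nullary.Decidable using (True; False; toWitness; toWitnessFalse)
open import Relation.Unary using (Pred; Decidable; _∈_; _∉_; _∪_; _⊆_; _⊥_; ∅; ｛_｝)

private
  variable
    n k l r : ℕ

-- Conservation of cups

point : Fin n → ℕ → Config n
point x r = updateAt (λ _ → 0) x (λ _ → r)

sum-point : ∀ (x : Fin n) r → sum (point x r) ≡ r
sum-point {suc n} x r = begin
  sum (point x r)                             ≡⟨ sum-remove {i = x} (point x r) ⟩
  point x r x + sum (removeAt (point x r) x)  ≡⟨ cong₂ _+_ (updateAt-updates x _)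
                                                              (sum-cong-≗ off-x) ⟩
  r + sum {n} (λ _ → 0)                       ≡⟨ cong (r +_) (sum-replicate-zero n) ⟩
  r + 0                                       ≡⟨ +-identityʳ r ⟩
  r                                           ∎
  where
  open ≡-Reasoning
  off-x : ∀ j → point x r (punchIn x j) ≡ 0
  off-x j = updateAt-minimal (punchIn x j) x _ (punchInᵢ≢i x j)

sum-initial : ∀ n → sum (initial {n}) ≡ n
sum-initial zero    = refl
sum-initial (suc n) = cong suc (sum-initial n)

sum-move : ∀ {G : Graph n} {c c′} → Move G c c′ → sum c′ ≡ sum c
sum-move {c = c} {c′} mv = +-cancelʳ-≡ (c from) (sum c′) (sum c) (begin
  sum c′ + c from                            ≡⟨ cong (sum c′ +_) (sum-point from (c from)) ⟨
  sum c′ + sum (point from (c from))         ≡⟨ ∑-distrib-+ c′ _ ⟨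
  sum (λ v → c′ v + point from (c from) v)  ≡⟨ sum-cong-≗ balance ⟩
  sum (λ v → c v + point to (c from) v)      ≡⟨ ∑-distrib-+ c _ ⟩
  sum c + sum (point to (c from))            ≡⟨ cong (sum c +_) (sum-point to (c from)) ⟩
  sum c + c from                             ∎)
  where
  open Move mv
  open ≡-Reasoning
  balance : ∀ v → c′ v + point from (c from) v ≡ c v + point to (c from) v
  balance v with v ≟ from | v ≟ to
  ... | yes refl | yes v≡to = contradiction v≡to distinct
  ... | yes refl | no v≢to  = begin
    c′ from + point from (c from) from  ≡⟨ cong₂ _+_ emptied (updateAt-updates from _) ⟩
    c from                              ≡⟨ +-identityʳ (c from) ⟨
    c from + 0                          ≡⟨ cong (c from +_) (updateAt-minimal from to _ v≢to) ⟨
    c from + point to (c from) from     ∎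
  ... | no v≢from | yes refl = begin
    c′ to + point from (c from) to  ≡⟨ cong₂ _+_ stacked (updateAt-minimal to from _ v≢from) ⟩
    c to + c from + 0               ≡⟨ +-identityʳ _ ⟩
    c to + c from                   ≡⟨ cong (c to +_) (updateAt-updates to _) ⟨
    c to + point to (c from) to     ∎
  ... | no v≢from | no v≢to = cong₂ _+_ (unchanged v v≢from v≢to)
    (trans (updateAt-minimal v from _ v≢from) (sym (updateAt-minimal v to _ v≢to)))

sum-moves : ∀ {G : Graph n} {c c′} → Star (Move G) c c′ → sum c′ ≡ sum c
sum-moves ε          = refl
sum-moves (mv ◅ mvs) = trans (sum-moves mvs) (sum-move mv)

sum≡0⇒≡0 : (c : Config n) → sum c ≡ 0 → ∀ v → c v ≡ 0
sum≡0⇒≡0 c total≡0 zero    = m+n≡0⇒m≡0 (c zero) total≡0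
sum≡0⇒≡0 c total≡0 (suc v) = sum≡0⇒≡0 (c ∘ suc) (m+n≡0⇒n≡0 (c zero) total≡0) v

sum-concentrated : ∀ (c : Config n) {t} → sum c ≡ c t → ∀ v → v ≢ t → c v ≡ 0
sum-concentrated {suc n} c {t} total≡ v v≢t = begin
  c v                              ≡⟨ cong c (punchIn-punchOut (v≢t ∘ sym)) ⟨
  removeAt c t (punchOut (v≢t ∘ sym))  ≡⟨ sum≡0⇒≡0 (removeAt c t) rest≡0 _ ⟩
  0                                ∎
  where
  open ≡-Reasoning
  rest≡0 : sum (removeAt c t) ≡ 0
  rest≡0 = +-cancelˡ-≡ (c t) _ 0
    (trans (sym (sum-remove {i = t} c)) (trans total≡ (sym (+-identityʳ (c t)))))

all-on : ∀ {G : Graph n} {c t} → Star (Move G) initial c → c t ≡ n → AllOn t c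
all-on {n} {c = c} mvs ct≡n =
  ct≡n , sum-concentrated c (trans (sum-moves mvs) (trans (sum-initial n) (sym ct≡n)))

module _ {n : ℕ} {G : Graph n} where

  snoc : ∀ {x y z} → Walk G x y k → adj G y z ≡ true → Walk G x z (suc k)
  snoc here        e = step e here
  snoc (step a w) e = step a (snoc w e)

  reverse : ∀ {x y} → Walk G x y k → Walk G y x k
  reverse here                 = here
  reverse (step {x} {z} a w) = snoc (reverse w) (trans (Graph.sym G z x) a)

  map-walk : ∀ {H : Graph n} {x y} → G ⊆G H → Walk G x y k → Walk H x y k
  map-walk G⊆H here                 = here
  map-walk G⊆H (step {x} {z} a w) = step (G⊆H x z a) (map-walk G⊆H w)

  line-walk : (ℓ : Fin (suc k) → Fin n) → (∀ i → adj G (ℓ (inject₁ i)) (ℓ (suc i)) ≡ true) →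
              Walk G (ℓ zero) (ℓ (fromℕ k)) k
  line-walk {zero}  ℓ consecutive = here
  line-walk {suc k} ℓ consecutive =
    step (consecutive zero) (line-walk (ℓ ∘ suc) (consecutive ∘ suc))

  Dist-≤ : ∀ {x y} → Dist G x y r → Walk G x y k → r ≤ k
  Dist-≤ {r} {k} (_ , shortest) w with r ≤? k
  ... | yes r≤k = r≤k
  ... | no  r≰k = contradiction w (shortest k (≰⇒> r≰k))

  Dist-self : ∀ {x} → Dist G x x r → r ≡ 0
  Dist-self d = n≤0⇒n≡0 (Dist-≤ d here)

  Dist⇒≢ : ∀ {x y} → Dist G x y (suc r) → x ≢ y
  Dist⇒≢ d refl with () ← Dist-self d

-- The graph of an integer metric

module MetricGraph {n : ℕ} (D : Fin n → Fin n → ℕ)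
  (D-sym : ∀ x y → D x y ≡ D y x)
  (D-self : ∀ x → D x x ≡ 0)
  (D-triangle : ∀ x y z → D x z ≤ D x y + D y z) where

  graph : Graph n
  graph = record
    { adj    = λ x y → D x y ≡ᵇ 1
    ; sym    = λ x y → cong (_≡ᵇ 1) (D-sym x y)
    ; irrefl = λ x → cong (_≡ᵇ 1) (D-self x)
    }

  D≡1⇒adjacent : ∀ {x y} → D x y ≡ 1 → adj graph x y ≡ true
  D≡1⇒adjacent e rewrite e = refl

  adjacent⇒D≡1 : ∀ {x y} → adj graph x y ≡ true → D x y ≡ 1
  adjacent⇒D≡1 {x} {y} e = ≡ᵇ⇒≡ (D x y) 1 (Equivalence.from T-≡ e)

  D≤length : ∀ {x y} → Walk graph x y k → D x y ≤ k
  D≤length {x = x} here = ≤-reflexive (D-self x)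
  D≤length {x = x} {y} (step {z = z} a w) = begin
    D x y          ≤⟨ D-triangle x z y ⟩
    D x z + D z y  ≡⟨ cong (_+ D z y) (adjacent⇒D≡1 a) ⟩
    suc (D z y)    ≤⟨ s≤s (D≤length w) ⟩
    suc _          ∎
    where open ≤-Reasoning

  geodesic-walk⇒Dist : ∀ {x y} → Walk graph x y (D x y) → Dist graph x y (D x y)
  geodesic-walk⇒Dist w = w , λ k k<D w′ → <⇒≱ k<D (D≤length w′)

module _ {n : ℕ} (G : Graph n) (c : Fin n) where

  private
    is-c : Fin n → Bool
    is-c x = does (x ≟ c)

    spoke : Fin n → Fin n → Bool
    spoke x y = (is-c x ∧ not (is-c y)) ∨ (is-c y ∧ not (is-c x))

  universalise : Graph n
  universalise = record
    { adj    = λ x y → adj G x y ∨ spoke x y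
    ; sym    = λ x y → cong₂ _∨_ (Graph.sym G x y) (∨-comm (is-c x ∧ not (is-c y)) _)
    ; irrefl = λ x → cong₂ _∨_ (irrefl G x) (cong₂ _∨_ (∧-inverseʳ (is-c x)) (∧-inverseʳ (is-c x)))
    }

  ⊆-universalise : G ⊆G universalise
  ⊆-universalise x y e rewrite e = refl

  universalise-universal : ∀ {y} → y ≢ c → adj universalise c y ≡ true
  universalise-universal {y} y≢c with c ≟ c | y ≟ c
  ... | yes _  | no _      = ∨-zeroʳ (adj G c y)
  ... | yes _  | yes y≡c   = contradiction y≡c y≢c
  ... | no c≢c | _         = contradiction refl c≢c

  universalise-pendant : ∀ {v} → v ≢ c → (∀ {y} → adj G v y ≡ true → y ≡ c) →
                         ∀ {y} → adj universalise v y ≡ true → y ≡ c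
  universalise-pendant {v} v≢c pendant {y} e with v ≟ c | y ≟ c
  ... | yes v≡c | _       = contradiction v≡c v≢c
  ... | no _    | yes y≡c = y≡c
  ... | no _    | no _    = pendant (trans (sym (∨-identityʳ (adj G v y))) e)

-- Sweeping cups onto a vertex

module Sweeping {n : ℕ} (G : Graph n) where

  record Swept (c : Config n) (S : Pred (Fin n) 0ℓ) (k : ℕ) (t : Fin n) : Set where
    field
      {final} : Config n
      moves   : Star (Move G) c final
      gain    : final t ≡ c t + k
      frame   : ∀ {v} → v ∉ S → v ≢ t → final v ≡ c v

  open Swept

  Sweep : Pred (Fin n) 0ℓ → ℕ → Fin n → Set
  Sweep S k t = ∀ c → (∀ {v} → v ∈ S → c v ≡ 1) → 1 ≤ c t → Swept c S k t

  private
    variable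
      S S′ : Pred (Fin n) 0ℓ
      t x : Fin n

  stackable-at : Sweep S k t → suc k ≡ n → Stackable-at G t
  stackable-at {S} {k} {t} sweep 1+k≡n =
    final o , moves o , all-on (moves o) (trans (gain o) 1+k≡n)
    where
    o : Swept initial S k t
    o = sweep initial (λ _ → refl) ≤-refl

  stay : Sweep ∅ 0 t
  stay c _ _ = record { moves = ε ; gain = sym (+-identityʳ _) ; frame = λ _ _ → refl }

  weaken : S ⊆ S′ → Sweep S k t → Sweep S′ k t
  weaken {S} {S′} {k} {t} S⊆S′ sweep c ones occupied = record
    { moves = moves o ; gain = gain o ; frame = λ v∉S′ → frame o (v∉S′ ∘ S⊆S′) }
    where
    o : Swept c S k t
    o = sweep c (ones ∘ S⊆S′) occupied

  shift : Config n → Fin n → Fin n → Config n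
  shift c x y = updateAt (updateAt c y (_+ c x)) x (λ _ → 0)

  move : ∀ {c y} → Dist G x y (c x) → 1 ≤ c x → 1 ≤ c y → Move G c (shift c x y)
  move {x} {c} {y} d 1≤cx 1≤cy = record
    { from = x ; to = y ; distinct = x≢y ; nonempty = 1≤cx ; occupied = 1≤cy ; distance = d
    ; emptied   = updateAt-updates x _
    ; stacked   = trans (updateAt-minimal y x _ (x≢y ∘ sym)) (updateAt-updates y c)
    ; unchanged = λ v v≢x v≢y → trans (updateAt-minimal v x _ v≢x) (updateAt-minimal v y c v≢y)
    }
    where
    x≢y : x ≢ y
    x≢y refl = <⇒≢ 1≤cx (sym (Dist-self d))

  relay : Sweep S k x → Dist G x t (suc k) → t ∉ S → Sweep (S ∪ ｛ x ｝) (suc k) t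
  relay {S} {k} {x} {t} sweep d t∉S c ones 1≤ct = record
    { moves = moves o ◅◅ (mv ◅ ε)
    ; gain  = trans (Move.stacked mv) (cong₂ _+_ c₁t c₁x)
    ; frame = λ v∉ v≢t → let v≢x = v∉ ∘ inj₂ ∘ sym in
        trans (Move.unchanged mv _ v≢x v≢t) (frame o (v∉ ∘ inj₁) v≢x)
    }
    where
    o : Swept c S k x
    o = sweep c (ones ∘ inj₁) (≤-reflexive (sym (ones (inj₂ refl))))
    c₁x : final o x ≡ suc k
    c₁x = trans (gain o) (cong (_+ k) (ones (inj₂ refl)))
    c₁t : final o t ≡ c t
    c₁t = frame o t∉S (Dist⇒≢ d ∘ sym)
    mv : Move G (final o) (shift (final o) x t)
    mv = move (subst (Dist G x t) (sym c₁x) d)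
              (subst (1 ≤_) (sym c₁x) (s≤s z≤n))
              (subst (1 ≤_) (sym c₁t) 1≤ct)

  combine : Sweep S k t → Sweep S′ l t → S′ ⊥ S → t ∉ S′ → Sweep (S ∪ S′) (k + l) t
  combine {S} {k} {t} {S′} {l} first second S′⊥S t∉S′ c ones 1≤ct = record
    { moves = moves o₁ ◅◅ moves o₂
    ; gain  = trans (gain o₂) (trans (cong (_+ l) (gain o₁)) (+-assoc (c t) k l))
    ; frame = λ v∉ v≢t → trans (frame o₂ (v∉ ∘ inj₂) v≢t) (frame o₁ (v∉ ∘ inj₁) v≢t)
    }
    where
    o₁ : Swept c S k t
    o₁ = first c (ones ∘ inj₁) 1≤ct
    ones′ : ∀ {v} → v ∈ S′ → final o₁ v ≡ 1
    ones′ v∈S′ =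
      trans (frame o₁ (λ v∈S → S′⊥S (v∈S′ , v∈S)) (λ { refl → t∉S′ v∈S′ })) (ones (inj₂ v∈S′))
    o₂ : Swept (final o₁) S′ l t
    o₂ = second (final o₁) ones′ (subst (1 ≤_) (sym (gain o₁)) (≤-trans 1≤ct (m≤m+n (c t) k)))

  Geodesic : (Fin (suc k) → Fin n) → Set
  Geodesic ℓ = ∀ i j → Dist G (ℓ i) (ℓ j) ∣ toℕ i - toℕ j ∣

  Image : (Fin k → Fin n) → Pred (Fin n) 0ℓ
  Image ℓ v = ∃ λ i → ℓ i ≡ v

  geodesic-injective : ∀ {ℓ : Fin (suc k) → Fin n} → Geodesic ℓ → ∀ {i j} → ℓ i ≡ ℓ j → i ≡ j
  geodesic-injective {ℓ = ℓ} geo {i} {j} e =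
    toℕ-injective (∣m-n∣≡0⇒m≡n (Dist-self (subst (λ v → Dist G v (ℓ j) _) e (geo i j))))

  mutual
    sweep-to-first : (ℓ : Fin (suc k) → Fin n) → Geodesic ℓ → Sweep (Image (ℓ ∘ suc)) k (ℓ zero)
    sweep-to-first {zero}  ℓ geo = weaken (λ ()) stay
    sweep-to-first {suc k} ℓ geo =
      weaken covered (relay (sweep-to-last (ℓ ∘ suc) (λ i j → geo (suc i) (suc j))) far fresh)
      where
      far : Dist G (ℓ (suc (fromℕ k))) (ℓ zero) (suc k)
      far = subst (Dist G (ℓ (suc (fromℕ k))) (ℓ zero) ∘ suc) (toℕ-fromℕ k)
                  (geo (suc (fromℕ k)) zero)
      fresh : ℓ zero ∉ Image (ℓ ∘ suc ∘ inject₁)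
      fresh (i , e) with () ← geodesic-injective geo e
      covered : Image (ℓ ∘ suc ∘ inject₁) ∪ ｛ ℓ (suc (fromℕ k)) ｝ ⊆ Image (ℓ ∘ suc)
      covered (inj₁ (i , e)) = inject₁ i , e
      covered (inj₂ e)       = fromℕ k , e

    sweep-to-last : (ℓ : Fin (suc k) → Fin n) → Geodesic ℓ →
                    Sweep (Image (ℓ ∘ inject₁)) k (ℓ (fromℕ k))
    sweep-to-last {zero}  ℓ geo = weaken (λ ()) stay
    sweep-to-last {suc k} ℓ geo =
      weaken covered (relay (sweep-to-first (ℓ ∘ inject₁) geo′) far fresh)
      where
      geo′ : Geodesic (ℓ ∘ inject₁)
      geo′ i j = subst₂ (λ a b → Dist G (ℓ (inject₁ i)) (ℓ (inject₁ j)) ∣ a - b ∣)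
                        (toℕ-inject₁ i) (toℕ-inject₁ j) (geo (inject₁ i) (inject₁ j))
      far : Dist G (ℓ zero) (ℓ (suc (fromℕ k))) (suc k)
      far = subst (Dist G (ℓ zero) (ℓ (suc (fromℕ k))) ∘ suc) (toℕ-fromℕ k)
                  (geo zero (suc (fromℕ k)))
      fresh : ℓ (suc (fromℕ k)) ∉ Image (ℓ ∘ inject₁ ∘ suc)
      fresh (i , e) = fromℕ≢inject₁ (Fin-suc-injective (sym (geodesic-injective geo e)))
      covered : Image (ℓ ∘ inject₁ ∘ suc) ∪ ｛ ℓ zero ｝ ⊆ Image (ℓ ∘ inject₁)
      covered (inj₁ (i , e)) = suc i , e
      covered (inj₂ e)       = zero , e

-- A centre with two pendant neighbours

module Blocking {n : ℕ} (H : Graph n) {centre a b : Fin n}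
  (universal : ∀ {y} → y ≢ centre → adj H centre y ≡ true)
  (a-pendant : ∀ {y} → adj H a y ≡ true → y ≡ centre)
  (b-pendant : ∀ {y} → adj H b y ≡ true → y ≡ centre)
  (a≢centre : a ≢ centre) (b≢centre : b ≢ centre) (a≢b : a ≢ b) where

  Pinned : ℕ → Set
  Pinned r = r ≡ 1 ⊎ 3 ≤ r

  ¬Pinned-0 : ¬ Pinned 0
  ¬Pinned-0 (inj₁ ())
  ¬Pinned-0 (inj₂ ())

  centre-eccentricity : ∀ {y} → Dist H centre y r → r ≤ 1
  centre-eccentricity {y = y} d with y ≟ centre
  ... | yes refl = ≤-trans (Dist-≤ d here) z≤n
  ... | no y≢c   = Dist-≤ d (step (universal y≢c) here)

  module Pendant {v : Fin n} (pendant : ∀ {y} → adj H v y ≡ true → y ≡ centre)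
                 (v≢centre : v ≢ centre) where

    to-centre : adj H v centre ≡ true
    to-centre = trans (Graph.sym H v centre) (universal v≢centre)

    eccentricity : ∀ {y} → Dist H v y r → r ≤ 2
    eccentricity {y = y} d with y ≟ centre
    ... | yes refl = ≤-trans (Dist-≤ d (step to-centre here)) (s≤s z≤n)
    ... | no y≢c   = Dist-≤ d (step to-centre (step (universal y≢c) here))

    neighbour : ∀ {x} → Dist H x v 1 → x ≡ centre
    neighbour {x} (step e here , _) = pendant (trans (Graph.sym H v x) e)

    cannot-leave : ∀ {y} → Dist H v y r → y ≢ centre → ¬ Pinned r
    cannot-leave d y≢c (inj₁ refl) with step e here , _ ← d = y≢c (pendant e)
    cannot-leave d y≢c (inj₂ 3≤r) = <⇒≱ 3≤r (eccentricity d)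

    heavy-arrival : ∀ {x} → Dist H x v r → x ≢ centre → 1 ≤ r → 2 ≤ r
    heavy-arrival {r = suc zero}    d x≢c _ = contradiction (neighbour d) x≢c
    heavy-arrival {r = suc (suc _)} _ _   _ = s≤s (s≤s z≤n)

    pinned-step : ∀ {c c′} (mv : Move H c c′) → Move.from mv ≢ centre → Move.to mv ≢ centre →
                  Pinned (c v) → Pinned (c′ v)
    pinned-step mv from≢c to≢c pinned with v ≟ Move.from mv | v ≟ Move.to mv
    ... | yes refl | _ = contradiction pinned (cannot-leave distance to≢c)
      where open Move mv
    ... | no _ | yes refl =
      inj₂ (subst (3 ≤_) (sym stacked) (+-mono-≤ occupied (heavy-arrival distance from≢c nonempty)))
      where open Move mv
    ... | no v≢from | no v≢to = subst Pinned (sym (Move.unchanged mv v v≢from v≢to)) pinned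

  module A = Pendant a-pendant a≢centre
  module B = Pendant b-pendant b≢centre

  Blocked : Config n → Set
  Blocked c = 2 ≤ c centre
            ⊎ (c centre ≡ 1 × Pinned (c a) × Pinned (c b))
            ⊎ (c centre ≡ 0 × (Pinned (c a) ⊎ Pinned (c b)))

  private
    variable
      c c′ : Config n

  blocked-step-≥2 : (mv : Move H c c′) → 2 ≤ c centre → Blocked c′
  blocked-step-≥2 mv 2≤c with Move.to mv ≟ centre
  ... | yes refl = inj₁ (subst (2 ≤_) (sym stacked) (≤-trans 2≤c (m≤m+n _ _)))
    where open Move mv
  ... | no to≢c  = inj₁ (subst (2 ≤_) (sym (unchanged centre (from≢c ∘ sym) (to≢c ∘ sym))) 2≤c)
    where
    open Move mv
    from≢c : from ≢ centre
    from≢c refl = <⇒≱ 2≤c (centre-eccentricity distance)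

  blocked-step-≡1 : (mv : Move H c c′) → c centre ≡ 1 → Pinned (c a) → Pinned (c b) → Blocked c′
  blocked-step-≡1 mv c≡1 pa pb with Move.from mv ≟ centre | Move.to mv ≟ centre
  ... | yes refl | _ with Move.to mv ≟ a
  ...   | yes refl =
    inj₂ (inj₂ (emptied , inj₂ (subst Pinned (sym (unchanged b b≢centre (a≢b ∘ sym))) pb)))
    where open Move mv
  ...   | no to≢a  =
    inj₂ (inj₂ (emptied , inj₁ (subst Pinned (sym (unchanged a a≢centre (to≢a ∘ sym))) pa)))
    where open Move mv
  blocked-step-≡1 {c} mv c≡1 pa pb | no from≢c | yes refl =
    inj₁ (subst (2 ≤_) (sym (trans stacked (cong (_+ c from) c≡1))) (s≤s nonempty))
    where open Move mv
  blocked-step-≡1 mv c≡1 pa pb | no from≢c | no to≢c =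
    inj₂ (inj₁ (trans (unchanged centre (from≢c ∘ sym) (to≢c ∘ sym)) c≡1 ,
                A.pinned-step mv from≢c to≢c pa , B.pinned-step mv from≢c to≢c pb))
    where open Move mv

  blocked-step-≡0 : (mv : Move H c c′) → c centre ≡ 0 → Pinned (c a) ⊎ Pinned (c b) → Blocked c′
  blocked-step-≡0 {c} {c′} mv c≡0 pinned =
    inj₂ (inj₂ (trans (unchanged centre (from≢c ∘ sym) (to≢c ∘ sym)) c≡0 , Sum.map pa′ pb′ pinned))
    where
    open Move mv
    from≢c : from ≢ centre
    from≢c refl = <⇒≢ nonempty (sym c≡0)
    to≢c : to ≢ centre
    to≢c refl = <⇒≢ occupied (sym c≡0)
    pa′ : Pinned (c a) → Pinned (c′ a)
    pa′ = A.pinned-step mv from≢c to≢c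
    pb′ : Pinned (c b) → Pinned (c′ b)
    pb′ = B.pinned-step mv from≢c to≢c

  blocked-step : Move H c c′ → Blocked c → Blocked c′
  blocked-step mv (inj₁ 2≤c)                    = blocked-step-≥2 mv 2≤c
  blocked-step mv (inj₂ (inj₁ (c≡1 , pa , pb))) = blocked-step-≡1 mv c≡1 pa pb
  blocked-step mv (inj₂ (inj₂ (c≡0 , pinned)))  = blocked-step-≡0 mv c≡0 pinned

  blocked-moves : Star (Move H) c c′ → Blocked c → Blocked c′
  blocked-moves ε          blocked = blocked
  blocked-moves (mv ◅ mvs) blocked = blocked-moves mvs (blocked-step mv blocked)

  not-stackable-at : ∀ {t} → t ≢ centre → t ≢ a → t ≢ b → ¬ Stackable-at H t
  not-stackable-at {t} t≢c t≢a t≢b (c , mvs , _ , empty)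
    with blocked-moves mvs (inj₂ (inj₁ (refl , inj₁ refl , inj₁ refl)))
  ... | inj₁ 2≤c                  = contradiction (subst (2 ≤_) (empty centre (t≢c ∘ sym)) 2≤c) λ ()
  ... | inj₂ (inj₁ (c≡1 , _))     = contradiction (trans (sym c≡1) (empty centre (t≢c ∘ sym))) λ ()
  ... | inj₂ (inj₂ (_ , inj₁ pa)) = ¬Pinned-0 (subst Pinned (empty a (t≢a ∘ sym)) pa)
  ... | inj₂ (inj₂ (_ , inj₂ pb)) = ¬Pinned-0 (subst Pinned (empty b (t≢b ∘ sym)) pb)

-- Vertices are numbered by position: 0 is the leaf b, 1 the leaf a, 2 the centre c and
-- 2 + j the handle vertex p_j, so that the positions 1, 2, 3, … run along the path.
broom-dist : ℕ → ℕ → ℕ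
broom-dist zero    zero    = 0
broom-dist zero    (suc q) = suc ∣ 1 - q ∣
broom-dist (suc p) zero    = suc ∣ p - 1 ∣
broom-dist (suc p) (suc q) = ∣ p - q ∣

broom-dist-sym : ∀ p q → broom-dist p q ≡ broom-dist q p
broom-dist-sym zero    zero    = refl
broom-dist-sym zero    (suc q) = cong suc (∣-∣-comm 1 q)
broom-dist-sym (suc p) zero    = cong suc (∣-∣-comm p 1)
broom-dist-sym (suc p) (suc q) = ∣-∣-comm p q

broom-dist-self : ∀ p → broom-dist p p ≡ 0
broom-dist-self zero    = refl
broom-dist-self (suc p) = ∣n-n∣≡0 p

broom-dist-triangle : ∀ p q r → broom-dist p r ≤ broom-dist p q + broom-dist q r
broom-dist-triangle zero    zero    zero    = z≤n
broom-dist-triangle zero    zero    (suc r) = ≤-refl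
broom-dist-triangle zero    (suc q) zero    = z≤n
broom-dist-triangle zero    (suc q) (suc r) = s≤s (∣-∣-triangle 1 q r)
broom-dist-triangle (suc p) zero    zero    = m≤m+n _ 0
broom-dist-triangle (suc p) zero    (suc r) =
  ≤-trans (∣-∣-triangle p 1 r) (+-mono-≤ (n≤1+n _) (n≤1+n _))
broom-dist-triangle (suc p) (suc q) zero    =
  ≤-trans (s≤s (∣-∣-triangle p q 1)) (≤-reflexive (sym (+-suc ∣ p - q ∣ ∣ q - 1 ∣)))
broom-dist-triangle (suc p) (suc q) (suc r) = ∣-∣-triangle p q r

module Broom (L : ℕ) where

  D : Fin (3 + L) → Fin (3 + L) → ℕ
  D x y = broom-dist (toℕ x) (toℕ y)

  open MetricGraph D (λ x y → broom-dist-sym (toℕ x) (toℕ y)) (λ x → broom-dist-self (toℕ x))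
                     (λ x y z → broom-dist-triangle (toℕ x) (toℕ y) (toℕ z))
    renaming (graph to G) public
  open Sweeping G public

  module Segment {s k : ℕ} (s+k<N : s + k < 3 + L) where

    vertex : Fin (suc k) → Fin (3 + L)
    vertex i = fromℕ< (≤-<-trans (+-monoʳ-≤ s (toℕ≤pred[n] i)) s+k<N)

    position : ∀ i → toℕ (vertex i) ≡ s + toℕ i
    position i = toℕ-fromℕ< _

    position-first : toℕ (vertex zero) ≡ s
    position-first = trans (position zero) (+-identityʳ s)

    position-last : toℕ (vertex (fromℕ k)) ≡ s + k
    position-last = trans (position (fromℕ k)) (cong (s +_) (toℕ-fromℕ k))

    distance : 1 ≤ s → ∀ i j → D (vertex i) (vertex j) ≡ ∣ toℕ i - toℕ j ∣
    distance (s≤s {n = s′} _) i j =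
      trans (cong₂ broom-dist (position i) (position j)) (∣m+n-m+o∣≡∣n-o∣ s′ (toℕ i) (toℕ j))

    consecutive : 1 ≤ s → ∀ i → adj G (vertex (inject₁ i)) (vertex (suc i)) ≡ true
    consecutive 1≤s i = D≡1⇒adjacent {vertex (inject₁ i)} {vertex (suc i)} (begin
      D (vertex (inject₁ i)) (vertex (suc i))  ≡⟨ distance 1≤s (inject₁ i) (suc i) ⟩
      ∣ toℕ (inject₁ i) - suc (toℕ i) ∣        ≡⟨ cong ∣_- suc (toℕ i) ∣ (toℕ-inject₁ i) ⟩
      ∣ toℕ i - suc (toℕ i) ∣                  ≡⟨ m≤n⇒∣m-n∣≡n∸m (n≤1+n (toℕ i)) ⟩
      suc (toℕ i) ∸ toℕ i                      ≡⟨ m+n∸n≡m 1 (toℕ i) ⟩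
      1                                        ∎)
      where open ≡-Reasoning

  path-walk : ∀ {x y} → 1 ≤ toℕ x → toℕ x ≤ toℕ y → Walk G x y (toℕ y ∸ toℕ x)
  path-walk {x} {y} 1≤x x≤y =
    subst₂ (λ u v → Walk G u v (toℕ y ∸ toℕ x)) first last (line-walk vertex (consecutive 1≤x))
    where
    x+k≡y : toℕ x + (toℕ y ∸ toℕ x) ≡ toℕ y
    x+k≡y = m+[n∸m]≡n x≤y
    open Segment {toℕ x} {toℕ y ∸ toℕ x} (subst (_< 3 + L) (sym x+k≡y) (toℕ<n y))
    first : vertex zero ≡ x
    first = toℕ-injective position-first
    last : vertex (fromℕ _) ≡ y
    last = toℕ-injective (trans position-last x+k≡y)

  path-walk-between : ∀ {x y} → 1 ≤ toℕ x → 1 ≤ toℕ y → Walk G x y ∣ toℕ x - toℕ y ∣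
  path-walk-between {x} {y} 1≤x 1≤y with ≤-total (toℕ x) (toℕ y)
  ... | inj₁ x≤y = subst (Walk G x y) (sym (m≤n⇒∣m-n∣≡n∸m x≤y)) (path-walk 1≤x x≤y)
  ... | inj₂ y≤x = subst (Walk G x y) (sym (m≤n⇒∣n-m∣≡n∸m y≤x)) (reverse (path-walk 1≤y y≤x))

  walk : ∀ x y → Walk G x y (D x y)
  walk zero    zero    = here
  walk zero    (suc y) =
    step (D≡1⇒adjacent {0F} {2F} refl) (path-walk-between {2F} {suc y} (s≤s z≤n) (s≤s z≤n))
  walk (suc x) zero    =
    subst (Walk G (suc x) zero) (broom-dist-sym 0 (suc (toℕ x))) (reverse (walk zero (suc x)))
  walk (suc x) (suc y) = path-walk-between (s≤s z≤n) (s≤s z≤n)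

  Dist-D : ∀ {x y r} → D x y ≡ r → Dist G x y r
  Dist-D {x} {y} refl = geodesic-walk⇒Dist (walk x y)

  connected-G : Connected G
  connected-G x y = D x y , walk x y

  Range : ℕ → ℕ → Pred (Fin (3 + L)) 0ℓ
  Range i j v = i ≤ toℕ v × toℕ v ≤ j

  range? : ∀ i j → Decidable (Range i j)
  range? i j v = (i ≤? toℕ v) ×-dec (toℕ v ≤? j)

  sweep-up : ∀ {t} j → 1 ≤ toℕ t → toℕ t ≤ j → j < 3 + L →
             Sweep (Range (suc (toℕ t)) j) (j ∸ toℕ t) t
  sweep-up {t} j 1≤t t≤j j<N =
    subst (Sweep _ _) (toℕ-injective position-first)
      (weaken inside (sweep-to-first vertex (λ i j → Dist-D (distance 1≤t i j))))
    where
    t+k≡j : toℕ t + (j ∸ toℕ t) ≡ j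
    t+k≡j = m+[n∸m]≡n t≤j
    open Segment {toℕ t} {j ∸ toℕ t} (subst (_< 3 + L) (sym t+k≡j) j<N)
    inside : Image (vertex ∘ suc) ⊆ Range (suc (toℕ t)) j
    inside (i , refl) = subst (λ p → suc (toℕ t) ≤ p × p ≤ j) (sym (position (suc i)))
      (m<m+n (toℕ t) (s≤s z≤n) , ≤-trans (+-monoʳ-≤ (toℕ t) (toℕ<n i)) (≤-reflexive t+k≡j))

  sweep-down : ∀ {t} i → 1 ≤ i → i ≤ toℕ t → Sweep (Range i (toℕ t)) (toℕ t ∸ i) t
  sweep-down {t} i 1≤i i≤t =
    subst (Sweep _ _) (toℕ-injective (trans position-last i+k≡t))
      (weaken inside (sweep-to-last vertex (λ i j → Dist-D (distance 1≤i i j))))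
    where
    i+k≡t : i + (toℕ t ∸ i) ≡ toℕ t
    i+k≡t = m+[n∸m]≡n i≤t
    open Segment {i} {toℕ t ∸ i} (subst (_< 3 + L) (sym i+k≡t) (toℕ<n t))
    inside : Image (vertex ∘ inject₁) ⊆ Range i (toℕ t)
    inside (j , refl) = subst (λ p → i ≤ p × p ≤ toℕ t) (sym (position (inject₁ j)))
      (m≤m+n i _ , ≤-trans (+-monoʳ-≤ i (toℕ≤pred[n] (inject₁ j))) (≤-reflexive i+k≡t))

  sweep-onto : ∀ {t} i j → 1 ≤ i → i ≤ toℕ t → toℕ t ≤ j → j < 3 + L →
               Sweep (Range i j) (j ∸ i) t
  sweep-onto {t} i j 1≤i i≤t t≤j j<N =
    subst (λ k → Sweep (Range i j) k t) count
      (weaken merge (combine (sweep-down i 1≤i i≤t) (sweep-up j (≤-trans 1≤i i≤t) t≤j j<N)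
                             apart fresh))
    where
    apart : Range (suc (toℕ t)) j ⊥ Range i (toℕ t)
    apart ((t<v , _) , (_ , v≤t)) = <⇒≱ t<v v≤t
    fresh : t ∉ Range (suc (toℕ t)) j
    fresh (t<t , _) = <-irrefl refl t<t
    merge : Range i (toℕ t) ∪ Range (suc (toℕ t)) j ⊆ Range i j
    merge (inj₁ (i≤v , v≤t)) = i≤v , ≤-trans v≤t t≤j
    merge (inj₂ (t<v , v≤j)) = ≤-trans i≤t (<⇒≤ t<v) , v≤j
    count : (toℕ t ∸ i) + (j ∸ toℕ t) ≡ j ∸ i
    count = +-cancelˡ-≡ i _ _ (begin
      i + ((toℕ t ∸ i) + (j ∸ toℕ t))  ≡⟨ +-assoc i _ _ ⟨
      i + (toℕ t ∸ i) + (j ∸ toℕ t)    ≡⟨ cong (_+ (j ∸ toℕ t)) (m+[n∸m]≡n i≤t) ⟩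
      toℕ t + (j ∸ toℕ t)              ≡⟨ m+[n∸m]≡n t≤j ⟩
      j                                ≡⟨ m+[n∸m]≡n (≤-trans i≤t t≤j) ⟨
      i + (j ∸ i)                      ∎)
      where open ≡-Reasoning

  -- `sweep-tail-to i e` collects the handle from position i to its end onto the vertex e
  -- steps before the end and relays that pile to t. The distance condition is an explicit
  -- equation because `_≟_` does not evaluate on positions that involve L.
  sweep-tail-to : ∀ {t} i e → broom-dist (2 + L ∸ e) (toℕ t) ≡ suc (2 + L ∸ i) →
                  {True (1 ≤? i)} → {True (i ≤? 2 + L ∸ e)} → {True (toℕ t <? i)} →
                  Sweep (Range i (2 + L)) (suc (2 + L ∸ i)) t
  sweep-tail-to {t} i e far {1≤i} {i≤s} {t<i} =
    weaken absorb (relay (sweep-onto i (2 + L) (toWitness 1≤i) i≤x x≤end ≤-refl) (Dist-D d) fresh)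
    where
    s : ℕ
    s = 2 + L ∸ e
    x : Fin (3 + L)
    x = fromℕ< (s≤s (m∸n≤m (2 + L) e))
    position-x : toℕ x ≡ s
    position-x = toℕ-fromℕ< _
    i≤x : i ≤ toℕ x
    i≤x = subst (i ≤_) (sym position-x) (toWitness i≤s)
    x≤end : toℕ x ≤ 2 + L
    x≤end = subst (_≤ 2 + L) (sym position-x) (m∸n≤m (2 + L) e)
    d : D x t ≡ suc (2 + L ∸ i)
    d = trans (cong (λ p → broom-dist p (toℕ t)) position-x) far
    fresh : t ∉ Range i (2 + L)
    fresh (i≤t , _) = <⇒≱ (toWitness t<i) i≤t
    absorb : Range i (2 + L) ∪ ｛ x ｝ ⊆ Range i (2 + L)
    absorb (inj₁ v∈) = v∈
    absorb (inj₂ refl) = i≤x , x≤end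

  open import Data.List.Membership.DecPropositional (_≟_ {3 + L}) using (_∈?_; _∉?_)

  -- The side conditions of `hop`, `_▸_`, `_⊕_` and `_⊕ᵗ_` concern concrete vertices; as
  -- `True`/`False` implicit arguments they are discharged by evaluation at each use.
  Listed : List (Fin (3 + L)) → Pred (Fin (3 + L)) 0ℓ
  Listed xs v = v ∈ₗ xs

  hop : ∀ {t} x → {True (D x t ℕ.≟ 1)} → Sweep (Listed [ x ]) 1 t
  hop x {d} = weaken only-x (relay stay (Dist-D (toWitness d)) λ ())
    where
    only-x : ∅ ∪ ｛ x ｝ ⊆ Listed [ x ]
    only-x (inj₂ refl) = here refl

  via : ∀ {xs k t} x → Sweep (Listed xs) k x →
        {True (D x t ℕ.≟ suc k)} → {False (t ∈? xs)} → Sweep (Listed (x ∷ xs)) (suc k) t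
  via {xs} x sweep {d} {fresh} =
    weaken push (relay sweep (Dist-D (toWitness d)) (toWitnessFalse fresh))
    where
    push : Listed xs ∪ ｛ x ｝ ⊆ Listed (x ∷ xs)
    push (inj₁ v∈xs) = there v∈xs
    push (inj₂ refl) = here refl

  syntax via x sweep = sweep ▸ x

  _⊕_ : ∀ {xs ys k l t} → Sweep (Listed xs) k t → Sweep (Listed ys) l t →
        {True (all? (_∉? xs) ys)} → {False (t ∈? ys)} → Sweep (Listed (xs ++ ys)) (k + l) t
  _⊕_ {xs} {ys} first second {apart} {fresh} =
    weaken join (combine first second (λ (v∈ys , v∈xs) → All.lookup (toWitness apart) v∈ys v∈xs)
                                      (toWitnessFalse fresh))
    where
    join : Listed xs ∪ Listed ys ⊆ Listed (xs ++ ys)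
    join (inj₁ v∈xs) = ∈-++⁺ˡ v∈xs
    join (inj₂ v∈ys) = ∈-++⁺ʳ xs v∈ys

  _⊕ᵗ_ : ∀ {xs k l i j t} → Sweep (Listed xs) k t → Sweep (Range i j) l t →
         {True (all? (¬? ∘ range? i j) xs)} → {False (range? i j t)} →
         Sweep (Listed xs ∪ Range i j) (k + l) t
  _⊕ᵗ_ first second {apart} {fresh} =
    combine first second (λ (v∈range , v∈xs) → All.lookup (toWitness apart) v∈xs v∈range)
                         (toWitnessFalse fresh)

  infixl 7 via
  infixl 6 _⊕_
  infixl 5 _⊕ᵗ_

  H : Graph (3 + L)
  H = universalise G 2F

  G⊆H : G ⊆G H
  G⊆H = ⊆-universalise G 2F

  b-pendant : ∀ {y} → adj G 0F y ≡ true → y ≡ 2F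
  b-pendant {0F}                ()
  b-pendant {1F}                ()
  b-pendant {2F}                _ = refl
  b-pendant {suc (suc (suc _))} ()

  a-pendant : ∀ {y} → adj G 1F y ≡ true → y ≡ 2F
  a-pendant {0F}                ()
  a-pendant {1F}                ()
  a-pendant {2F}                _ = refl
  a-pendant {suc (suc (suc _))} ()

  connected-H : Connected H
  connected-H x y = D x y , map-walk G⊆H (walk x y)

  open Blocking H {centre = 2F} {a = 1F} {b = 0F} (universalise-universal G 2F)
                  (universalise-pendant G 2F {1F} (λ ()) a-pendant)
                  (universalise-pendant G 2F {0F} (λ ()) b-pendant)
                  (λ ()) (λ ()) (λ ())
    using (not-stackable-at) public

-- A handle of length 12 + k is the shortest on which the strategy for p₁ fits: it passes
-- c → b → a → p₂ → p₆ → p₁, then p₃, p₅ → p₄ → p₁, and finally collects p₇, …, p_L on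
-- p_{L−5} and moves that pile to p₁.
module LongBroom (k : ℕ) where
  open Broom (12 + k) public

  stackable-at-b : Stackable-at G 0F
  stackable-at-b = stackable-at (hop 2F ▸ 1F ⊕ hop 4F ▸ 3F ⊕ᵗ sweep-tail-to 5 3 refl) refl

  stackable-at-a : Stackable-at G 1F
  stackable-at-a = stackable-at (hop 2F ▸ 0F ⊕ hop 4F ▸ 3F ⊕ᵗ sweep-tail-to 5 3 refl) refl

  stackable-at-c : Stackable-at G 2F
  stackable-at-c =
    stackable-at (hop 1F ⊕ hop 0F ⊕ᵗ sweep-up (14 + k) (s≤s z≤n) (m≤m+n 2 _) ≤-refl) refl

  stackable-at-p₁ : Stackable-at G 3F
  stackable-at-p₁ =
    stackable-at (hop 2F ▸ 0F ▸ 1F ▸ 4F ▸ 8F ⊕ (hop 5F ⊕ hop 7F) ▸ 6F ⊕ᵗ sweep-tail-to 9 5 refl)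
                 refl

  stackable-at-p₂ : Stackable-at G 4F
  stackable-at-p₂ =
    stackable-at (hop 2F ▸ 0F ▸ 1F ⊕ hop 3F ⊕ᵗ sweep-up (14 + k) (s≤s z≤n) (m≤m+n 4 _) ≤-refl) refl

  -- For p_j with j ≥ 3, the far part p_{j−2}, …, p_L of the handle is collected on p_j and
  -- the near part p₁, …, p_{j−3} together with both leaves on c, which then holds exactly
  -- d(c, p_j) = j cups.
  stackable-at-leg : (t′ : Fin (10 + k)) → Stackable-at G (suc (suc (suc (suc (suc t′)))))
  stackable-at-leg t′ = stackable-at (combine far near apart fresh) (cong suc count)
    where
    u : ℕ
    u = toℕ t′
    t : Fin (15 + k)
    t = suc (suc (suc (suc (suc t′))))
    3+u≤5+u : 3 + u ≤ 5 + u
    3+u≤5+u = +-monoˡ-≤ u (m≤m+n 3 2)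
    t≤end : 5 + u ≤ 14 + k
    t≤end = +-monoʳ-≤ 4 (toℕ<n t′)
    Near : Pred (Fin (15 + k)) 0ℓ
    Near = (Listed (1F ∷ 0F ∷ []) ∪ Range 3 (2 + u)) ∪ ｛ 2F ｝
    far : Sweep (Range (3 + u) (14 + k)) (14 + k ∸ (3 + u)) t
    far = sweep-onto (3 + u) (14 + k) (s≤s z≤n) 3+u≤5+u t≤end ≤-refl
    missed : t ∉ Listed (1F ∷ 0F ∷ []) ∪ Range 3 (2 + u)
    missed (inj₁ (here ()))
    missed (inj₁ (there (here ())))
    missed (inj₂ (_ , t≤2+u)) = <-irrefl refl (≤-trans 3+u≤5+u t≤2+u)
    near : Sweep Near (3 + u) t
    near = relay (hop 1F ⊕ hop 0F ⊕ᵗ sweep-up (2 + u) (s≤s z≤n) (m≤m+n 2 u) 2+u<N)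
                 (Dist-D refl) missed
      where
      2+u<N : 2 + u < 15 + k
      2+u<N = ≤-trans 3+u≤5+u (≤-trans t≤end (n≤1+n _))
    apart : Near ⊥ Range (3 + u) (14 + k)
    apart (inj₁ (inj₁ (here refl))         , (s≤s () , _))
    apart (inj₁ (inj₁ (there (here refl))) , (() , _))
    apart (inj₁ (inj₂ (_ , v≤2+u))          , (3+u≤v , _)) = <-irrefl refl (≤-trans 3+u≤v v≤2+u)
    apart (inj₂ refl                        , (s≤s (s≤s ()) , _))
    fresh : t ∉ Near
    fresh (inj₁ t∈) = missed t∈
    fresh (inj₂ ())
    count : 14 + k ∸ (3 + u) + (3 + u) ≡ 14 + k
    count = m∸n+n≡m (≤-trans 3+u≤5+u t≤end)

  stackable-G : Stackable G
  stackable-G 0F = stackable-at-b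
  stackable-G 1F = stackable-at-a
  stackable-G 2F = stackable-at-c
  stackable-G 3F = stackable-at-p₁
  stackable-G 4F = stackable-at-p₂
  stackable-G (suc (suc (suc (suc (suc t′))))) = stackable-at-leg t′

  not-stackable-H : ¬ Stackable H
  not-stackable-H stackable = not-stackable-at (λ ()) (λ ()) (λ ()) (stackable 3F)

theorem5p3 : ∀ (N : ℕ) → Σ ℕ λ n → n ≥ N × Σ (Graph n) λ G → Σ (Graph n) λ H →
               Connected G × Connected H × G ⊆G H × Stackable G × ¬ Stackable H
theorem5p3 N =
  15 + N , m≤n+m N 15 , G , H , connected-G , connected-H , G⊆H , stackable-G , not-stackable-H
  where open LongBroom N
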